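{- Let $T$ be a twin set of a connected graph $G$ with $|T|\geq 3$. Then $F_{xt}(G)\leq F_{xt}(G-u)$ for all $u\in T$.
   Context: All graphs are finite, simple; throughout the paper graphs are assumed connected and symmetric (nontrivial automorphism group). Two distinct vertices $u,v$ are twins if $N(u)\setminus\{v\}=N(v)\setminus\{u\}$, where $N(x)$ is the neighbourhood of $x$. A twin set is a set of vertices any two of which are twins. A fixing set of $G$ is a set $F\subseteq V(G)$ such that the only automorphism fixing every vertex of $F$ is the identity. A fixatic partition of $G$ is a partition of $V(G)$ into classes each of which is a fixing set; $F_{xt}(G)$ is the maximum number of classes in a fixatic partition. $G-u$ is the graph obtained by deleting $u$. -}

module Defs where

open import Data.Nat using (ℕ; suc; _≤_)
open import Data.Fin using (Fin; punchIn)
open import Data.Fin.Subset using (Subset; _∈_; ∣_∣)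
open import Data.Fin.Permutation using (Permutation′; _⟨$⟩ʳ_)
open import Data.Bool using (Bool; true; false)
open import Data.Product using (Σ; _×_; ∃-syntax)
open import Relation.Binary.PropositionalEquality using (_≡_; _≢_)
open import Relation.Nullary using (¬_)

record Graph (n : ℕ) : Set where
  field
    adj    : Fin n → Fin n → Bool
    irrefl : ∀ i → adj i i ≡ false
    sym    : ∀ i j → adj i j ≡ adj j i
open Graph public

Adj : ∀ {n} → Graph n → Fin n → Fin n → Set
Adj G i j = adj G i j ≡ true

data Reach {n} (G : Graph n) : Fin n → Fin n → Set where
  here : ∀ {i} → Reach G i i
  step : ∀ {i j k} → Adj G i j → Reach G j k → Reach G i k

Connected : ∀ {n} → Graph n → Set
Connected G = ∀ i j → Reach G i j

IsAutomorphism : ∀ {n} → Graph n → Permutation′ n → Set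
IsAutomorphism G σ = ∀ i j → adj G (σ ⟨$⟩ʳ i) (σ ⟨$⟩ʳ j) ≡ adj G i j

IsIdentity : ∀ {n} → Permutation′ n → Set
IsIdentity σ = ∀ i → σ ⟨$⟩ʳ i ≡ i

Symmetric : ∀ {n} → Graph n → Set
Symmetric G = ∃[ σ ] (IsAutomorphism G σ × ¬ IsIdentity σ)

FixingSet : ∀ {n} → Graph n → (Fin n → Set) → Set
FixingSet G F = ∀ σ → IsAutomorphism G σ → (∀ x → F x → σ ⟨$⟩ʳ x ≡ x) → IsIdentity σ

record FixaticPartition {n} (G : Graph n) (k : ℕ) : Set where
  field
    cls      : Fin n → Fin k
    nonempty : ∀ i → ∃[ x ] (cls x ≡ i)
    fixing   : ∀ i → FixingSet G (λ x → cls x ≡ i)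

IsFxt : ∀ {n} → Graph n → ℕ → Set
IsFxt G k = FixaticPartition G k × (∀ m → FixaticPartition G m → m ≤ k)

Twins : ∀ {n} → Graph n → Fin n → Fin n → Set
Twins G u v =
  u ≢ v × (∀ x → ((Adj G u x × x ≢ v) → (Adj G v x × x ≢ u))
                × ((Adj G v x × x ≢ u) → (Adj G u x × x ≢ v)))

TwinSet : ∀ {n} → Graph n → Subset n → Set
TwinSet G T = ∀ u v → u ∈ T → v ∈ T → u ≢ v → Twins G u v

deleteVertex : ∀ {m} → Graph (suc m) → Fin (suc m) → Graph m
deleteVertex G u = record
  { adj    = λ i j → adj G (punchIn u i) (punchIn u j)
  ; irrefl = λ i → irrefl G (punchIn u i)
  ; sym    = λ i j → sym G (punchIn u i) (punchIn u j)
  }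

module Submission where

-- If a and b are twins, the transposition (a b) is a graph
-- automorphism, and it fixes every vertex other than a and b.  Hence every
-- class of a fixatic partition -- being a fixing set -- must contain a or b.
-- A twin set T with |T| ≥ 3 contains three mutual twins a, b, c.  If a
-- fixatic partition had two classes, the class of a would differ from some
-- class C; then C must contain both b and c (using the pairs {a,b}, {a,c}),
-- so the class of a avoids both b and c, contradicting the pair {b,c}.
-- Thus F_xt(G) ≤ 1.  On the other hand G - u still has a vertex, and the
-- single class V(G - u) is trivially fixing, so F_xt(G - u) ≥ 1.

open import Defs
open import Data.Nat using (ℕ; zero; suc; _≤_; s≤s; z≤n; s≤s⁻¹)
open import Data.Nat.Properties using (≤-trans)
open import Data.Fin using (Fin; _≟_) renaming (zero to fzero; suc to fsuc)
open import Data.Fin.Subset using (Subset; _∈_; _∉_; _⊆_; ∣_∣; inside; outside)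
open import Data.Fin.Subset.Properties using (∣p∣≤n; out⊆; ⊆-refl)
open import Data.Fin.Permutation using (Permutation′; _⟨$⟩ʳ_; transpose)
open import Data.Vec using (_∷_; here; there)
open import Data.Bool.Properties using (⇔→≡)
open import Data.Product using (_×_; _,_; proj₁; proj₂; ∃-syntax)
open import Data.Sum using (_⊎_; inj₁; inj₂)
open import Data.Empty using (⊥-elim) renaming (⊥ to Empty)
open import Function.Bundles using (mk⇔)
open import Relation.Nullary using (¬_; yes; no)
open import Relation.Nullary.Decidable using (dec-true; dec-false)
open import Relation.Binary.PropositionalEquality
  using (_≡_; _≢_; refl; trans) renaming (sym to ≡-sym)

module _ {n : ℕ} (i j : Fin n) where

  transpose-left : transpose i j ⟨$⟩ʳ i ≡ j
  transpose-left rewrite dec-true (i ≟ i) refl = refl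

  transpose-right : transpose i j ⟨$⟩ʳ j ≡ i
  transpose-right with j ≟ i
  ... | yes j≡i = j≡i
  ... | no _ rewrite dec-true (j ≟ j) refl = refl

  transpose-away : ∀ {k} → k ≢ i → k ≢ j → transpose i j ⟨$⟩ʳ k ≡ k
  transpose-away {k} k≢i k≢j
    rewrite dec-false (k ≟ i) k≢i | dec-false (k ≟ j) k≢j = refl

module TwinSwap {n : ℕ} (G : Graph n) {a b : Fin n} (twins : Twins G a b) where

  τ : Permutation′ n
  τ = transpose a b

  sameNeighbour : ∀ w → w ≢ a → w ≢ b → adj G a w ≡ adj G b w
  sameNeighbour w w≢a w≢b = ⇔→≡ (mk⇔
    (λ a~w → proj₁ (proj₁ (proj₂ twins w) (a~w , w≢b)))
    (λ b~w → proj₁ (proj₂ (proj₂ twins w) (b~w , w≢a))))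

  sameNeighbourʳ : ∀ w → w ≢ a → w ≢ b → adj G w a ≡ adj G w b
  sameNeighbourʳ w w≢a w≢b =
    trans (sym G w a) (trans (sameNeighbour w w≢a w≢b) (sym G b w))

  data Position : Fin n → Set where
    atA  : Position a
    atB  : Position b
    away : ∀ {x} → x ≢ a → x ≢ b → Position x

  position : ∀ x → Position x
  position x with x ≟ a | x ≟ b
  ... | yes refl | _        = atA
  ... | no _     | yes refl = atB
  ... | no x≢a   | no x≢b   = away x≢a x≢b

  swapIsAutomorphism : IsAutomorphism G τ
  swapIsAutomorphism x y with position x | position y
  ... | atA | atA rewrite transpose-left a b =
    trans (irrefl G b) (≡-sym (irrefl G a))
  ... | atA | atB rewrite transpose-left a b | transpose-right a b = sym G b a
  ... | atA | away y≢a y≢b rewrite transpose-left a b | transpose-away a b y≢a y≢b =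
    ≡-sym (sameNeighbour y y≢a y≢b)
  ... | atB | atA rewrite transpose-left a b | transpose-right a b = sym G a b
  ... | atB | atB rewrite transpose-right a b =
    trans (irrefl G a) (≡-sym (irrefl G b))
  ... | atB | away y≢a y≢b rewrite transpose-right a b | transpose-away a b y≢a y≢b =
    sameNeighbour y y≢a y≢b
  ... | away x≢a x≢b | atA rewrite transpose-left a b | transpose-away a b x≢a x≢b =
    ≡-sym (sameNeighbourʳ x x≢a x≢b)
  ... | away x≢a x≢b | atB rewrite transpose-right a b | transpose-away a b x≢a x≢b =
    sameNeighbourʳ x x≢a x≢b
  ... | away x≢a x≢b | away y≢a y≢b rewrite transpose-away a b x≢a x≢b
                                          | transpose-away a b y≢a y≢b = refl

  swapIsNotIdentity : ¬ IsIdentity τ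
  swapIsNotIdentity τ≡id = proj₁ twins (trans (≡-sym (τ≡id a)) (transpose-left a b))

  -- Every fixing set contains a or b: otherwise τ fixes it pointwise.
  fixingSetMeetsTwins : (F : Fin n → Set) → FixingSet G F → ¬ F a → ¬ F b → Empty
  fixingSetMeetsTwins F fixing a∉F b∉F = swapIsNotIdentity (fixing τ swapIsAutomorphism
    (λ x x∈F → transpose-away a b (λ { refl → a∉F x∈F }) (λ { refl → b∉F x∈F })))

  classMeetsTwins : ∀ {k} (P : FixaticPartition G k) (i : Fin k) →
                    FixaticPartition.cls P a ≡ i ⊎ FixaticPartition.cls P b ≡ i
  classMeetsTwins P i with cls a ≟ i | cls b ≟ i
    where open FixaticPartition P
  ... | yes a∈i | _       = inj₁ a∈i
  ... | no _    | yes b∈i = inj₂ b∈i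
  ... | no a∉i  | no b∉i  =
    ⊥-elim (fixingSetMeetsTwins _ (FixaticPartition.fixing P i) a∉i b∉i)

record TwinTriple {n : ℕ} (G : Graph n) : Set where
  field
    a b c : Fin n
    ab : Twins G a b
    ac : Twins G a c
    bc : Twins G b c

otherClass : ∀ {k} (j : Fin (suc (suc k))) → ∃[ i ] (j ≢ i)
otherClass fzero    = fsuc fzero , λ ()
otherClass (fsuc _) = fzero , λ ()

-- A graph with three mutual twins has F_xt ≤ 1: a second class C, distinct
-- from the class of a, has to contain both b and c, and then the class of a
-- meets neither b nor c.
twinTripleBound : ∀ {n} {G : Graph n} → TwinTriple G →
                  ∀ {k} → FixaticPartition G k → k ≤ 1
twinTripleBound _ {zero}        _ = z≤n
twinTripleBound _ {suc zero}    _ = s≤s z≤n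
twinTripleBound {G = G} t {suc (suc k)} P with otherClass (cls a)
  where open FixaticPartition P; open TwinTriple t
... | i , a∉i = ⊥-elim (missesBC (TwinSwap.classMeetsTwins G bc P (cls a)))
  where
  open FixaticPartition P
  open TwinTriple t
  inClass : ∀ {x} → Twins G a x → cls x ≡ i
  inClass ax with TwinSwap.classMeetsTwins G ax P i
  ... | inj₁ a∈i = ⊥-elim (a∉i a∈i)
  ... | inj₂ x∈i = x∈i
  missesBC : ¬ (cls b ≡ cls a ⊎ cls c ≡ cls a)
  missesBC (inj₁ b∈a) = a∉i (trans (≡-sym b∈a) (inClass ab))
  missesBC (inj₂ c∈a) = a∉i (trans (≡-sym c∈a) (inClass ac))

splitMember : ∀ {n} k (p : Subset n) → suc k ≤ ∣ p ∣ →
              ∃[ x ] ∃[ q ] (x ∈ p × q ⊆ p × x ∉ q × k ≤ ∣ q ∣)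
splitMember k (inside ∷ p) (s≤s k≤∣p∣) =
  fzero , outside ∷ p , here , out⊆ ⊆-refl , (λ ()) , k≤∣p∣
splitMember k (outside ∷ p) k<∣p∣ with splitMember k p k<∣p∣
... | x , q , x∈p , q⊆p , x∉q , k≤∣q∣ =
  fsuc x , outside ∷ q , there x∈p , out⊆ q⊆p , (λ { (there x∈q) → x∉q x∈q }) , k≤∣q∣

separated : ∀ {n} {q : Subset n} {x y} → x ∈ q → y ∉ q → y ≢ x
separated x∈q y∉q refl = y∉q x∈q

twinTriple : ∀ {n} {G : Graph n} {T : Subset n} → TwinSet G T → 3 ≤ ∣ T ∣ → TwinTriple G
twinTriple {T = T} twins 3≤∣T∣ with splitMember 2 T 3≤∣T∣
... | a , T₁ , a∈T , T₁⊆T , a∉T₁ , 2≤∣T₁∣ with splitMember 1 T₁ 2≤∣T₁∣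
... | b , T₂ , b∈T₁ , T₂⊆T₁ , b∉T₂ , 1≤∣T₂∣ with splitMember 0 T₂ 1≤∣T₂∣
... | c , _ , c∈T₂ , _ = record
  { a = a ; b = b ; c = c
  ; ab = twins a b a∈T b∈T (separated b∈T₁ a∉T₁)
  ; ac = twins a c a∈T c∈T (separated (T₂⊆T₁ c∈T₂) a∉T₁)
  ; bc = twins b c b∈T c∈T (separated c∈T₂ b∉T₂)
  }
  where
  b∈T = T₁⊆T b∈T₁
  c∈T = T₁⊆T (T₂⊆T₁ c∈T₂)

oneClass : ∀ {n} (G : Graph (suc n)) → FixaticPartition G 1
oneClass G = record
  { cls      = λ _ → fzero
  ; nonempty = λ { fzero → fzero , refl }
  ; fixing   = λ { fzero σ _ fixesAll x → fixesAll x refl }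
  }

oneClassAfterDeletion : ∀ {m} (G : Graph (suc m)) (u : Fin (suc m)) → 1 ≤ m →
                        FixaticPartition (deleteVertex G u) 1
oneClassAfterDeletion {zero}  G u ()
oneClassAfterDeletion {suc _} G u _ = oneClass (deleteVertex G u)

mainTheorem8 : ∀ {m} (G : Graph (suc m)) → Connected G → Symmetric G →
    (T : Subset (suc m)) → TwinSet G T → 3 ≤ ∣ T ∣ →
    ∀ (u : Fin (suc m)) → u ∈ T →
    ∀ (k k′ : ℕ) → IsFxt G k → IsFxt (deleteVertex G u) k′ → k ≤ k′
mainTheorem8 {m} G _ _ T twins 3≤∣T∣ u _ k k′ (P , _) (_ , maximal′) =
  ≤-trans k≤1 (maximal′ 1 (oneClassAfterDeletion G u 1≤m))
  where
  k≤1 : k ≤ 1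
  k≤1 = twinTripleBound (twinTriple twins 3≤∣T∣) P
  -- G has at least three vertices, since |T| ≤ |V(G)|.
  1≤m : 1 ≤ m
  1≤m = ≤-trans (s≤s z≤n) (s≤s⁻¹ (≤-trans 3≤∣T∣ (∣p∣≤n T)))
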